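{- Let $\vec A\in\mathbb Z^{n\times n}$ with $n\ge2$. The monoid $\mathcal M=\{\vec A^0,\vec A^1,\vec A^2,\dots\}$ of powers of $\vec A$ is finite if and only if $|\mathcal M|\le 2^{n^3}$. -}

module Defs where

open import Data.Nat using (ℕ; zero; suc; _≤_)
open import Data.Integer using (ℤ; _+_; _*_; 0ℤ; 1ℤ)
open import Data.Fin using (Fin; _≟_)
open import Data.Vec using (Vec; tabulate; lookup; foldr′)
open import Data.List using (List; length)
open import Data.List.Membership.Propositional using (_∈_)
open import Data.Product using (∃; _×_)
open import Relation.Nullary.Decidable using (does)
open import Data.Bool using (if_then_else_)

-- n×n integer matrices, as vectors of rows (so ≡ is entrywise equality).
Matrix : ℕ → Set
Matrix n = Vec (Vec ℤ n) n

entry : ∀ {n} → Matrix n → Fin n → Fin n → ℤ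
entry M i j = lookup (lookup M i) j

sumℤ : ∀ {m} → Vec ℤ m → ℤ
sumℤ = foldr′ _+_ 0ℤ

identity : (n : ℕ) → Matrix n
identity n = tabulate λ i → tabulate λ j → if does (i ≟ j) then 1ℤ else 0ℤ

_⊗_ : ∀ {n} → Matrix n → Matrix n → Matrix n
A ⊗ B = tabulate λ i → tabulate λ j → sumℤ (tabulate λ k → entry A i k * entry B k j)

pow : ∀ {n} → Matrix n → ℕ → Matrix n
pow {n} A zero    = identity n
pow     A (suc k) = pow A k ⊗ A

PowersFinite : ∀ {n} → Matrix n → Set
PowersFinite A = ∃ λ (L : List _) → ∀ k → pow A k ∈ L

PowersCardLe : ∀ {n} → Matrix n → ℕ → Set
PowersCardLe A N = ∃ λ (L : List _) → (length L ≤ N) × (∀ k → pow A k ∈ L)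

{-# OPTIONS --safe #-}
-- Suppose the powers of A repeat, A^(i+P) = A^i.  Then A^i (I - A^P) = 0, and since the kernels of the
-- powers of an n×n matrix stop growing after n steps, already A^n = A^(n+P): the powers are periodic
-- from A^n on.  Among A^n, ..., A^(n + 3^(n²)) two agree modulo 3, say A^a ≡ A^(a+m).  Inside the
-- periodic part E = A^(aP) is idempotent and B = A^(aP+m) satisfies B^P = E and B ≡ E (mod 3).
-- Minkowski's argument shows B = E: writing B = E + Y, B^q = E + qY + (terms divisible by Y²), so if
-- 3^k divides Y then so does 3^(k+1), after first replacing B by B³ when 3 divides q.  Hence Y = 0,
-- A^(a+m) = A^a, and there are at most n + 3^(n²) ≤ 2^(n³) distinct powers.

module Submission where

open import Defs
open import Data.Nat using (ℕ; _≤_; _^_)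
open import Function.Bundles using (_⇔_)

open import Data.Nat as ℕ using (zero; suc; _<_; s≤s; z≤n)
import Data.Nat.Properties as ℕP
open import Data.Nat.Induction using (<-rec)
import Data.Nat.Tactic.RingSolver as ℕ-Solver
open import Data.Integer as ℤ using (ℤ; 0ℤ; 1ℤ; +_; -_; _+_; _*_; _-_)
import Data.Integer.Properties as ℤP
open import Data.Integer.Tactic.RingSolver using (solve-∀)
open import Data.Fin using (Fin; zero; suc; _≟_; punchIn; toℕ; fromℕ<; combine; remQuot; funToFin; finToFun)
import Data.Fin.Properties as FinP
open import Data.Fin.Properties using (all?; ¬∀⟶∃¬)
open import Data.Sum using ([_,_]′; inj₁; inj₂)
open import Data.Vec using (Vec; tabulate; lookup)
import Data.Vec.Properties as VecP
open import Data.Vec.Functional using (Vector; insertAt)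
open import Data.Vec.Functional.Properties using (insertAt-lookup; insertAt-punchIn)
open import Data.Integer.Divisibility.Signed
  using (_∣_; divides; ∣-trans; ∣m∣n⇒∣m+n; ∣m⇒∣-m; ∣m⇒∣m*n; ∣n⇒∣m*n; *-monoˡ-∣; *-monoʳ-∣; *-cancelˡ-∣; *-cancelʳ-∣; ∣⇒∣ᵤ; ∣ᵤ⇒∣)
import Data.Nat.Divisibility as ℕ
open import Data.Nat.Primality using (Prime; prime?; euclidsLemma)
open import Relation.Nullary.Decidable using (from-yes)
open import Data.Integer.DivMod using (_/ℕ_; _%ℕ_; n%ℕd<d; a≡a%ℕn+[a/ℕn]*n)
import Data.Nat.DivMod as ℕDM
open import Data.List as List using (length; applyUpTo)
import Data.List.Properties as ListP
import Data.List.Relation.Unary.Any as Any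
import Data.List.Relation.Unary.Any.Properties as AnyP
open import Data.List.Membership.Propositional using (_∈_)
open import Data.List.Membership.Propositional.Properties using (∈-applyUpTo⁺)
open import Function.Bundles using (mk⇔)
open import Data.Product using (∃; ∃₂; _×_; _,_; proj₁; proj₂)
open import Relation.Nullary using (¬_; yes; no; contradiction)
open import Relation.Binary.PropositionalEquality
open import Data.Bool using (if_then_else_)
open import Relation.Nullary.Decidable using (dec-true; dec-false)
open import Function using (_∘_; id)
open import Algebra.Properties.Semiring.Sum ℤP.+-*-semiring
  using (sum; sum-cong-≗; ∑-comm; ∑-distrib-+; *-distribˡ-sum; *-distribʳ-sum; sum-remove; sum-replicate-zero)
open import Algebra.Properties.Ring ℤP.+-*-ring using (x[y-z]≈xy-xz; [y-z]x≈yx-zx)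

open ≡-Reasoning

sumℤ-tabulate : ∀ {n} (f : Fin n → ℤ) → sumℤ (tabulate f) ≡ sum f
sumℤ-tabulate {zero}  f = refl
sumℤ-tabulate {suc n} f = cong (λ s → f zero + s) (sumℤ-tabulate (f ∘ suc))

sum-zero : ∀ {n} → sum {n} (λ _ → 0ℤ) ≡ 0ℤ
sum-zero {n} = sum-replicate-zero n

sum-neg : ∀ {n} (f : Fin n → ℤ) → sum (λ i → - f i) ≡ - sum f
sum-neg {zero}  f = refl
sum-neg {suc n} f = trans (cong (λ s → - f zero + s) (sum-neg (f ∘ suc))) (sym (ℤP.neg-distrib-+ (f zero) _))

sum-distrib-- : ∀ {n} (f g : Fin n → ℤ) → sum (λ i → f i - g i) ≡ sum f - sum g
sum-distrib-- f g = trans (∑-distrib-+ f (λ i → - g i)) (cong (λ s → sum f + s) (sum-neg g))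

sum-supported : ∀ {n} (f : Fin (suc n) → ℤ) (i : Fin (suc n)) →
                (∀ k → k ≢ i → f k ≡ 0ℤ) → sum f ≡ f i
sum-supported {n} f i f≡0 = begin
  sum f                          ≡⟨ sum-remove f ⟩
  f i + sum (f ∘ punchIn i)      ≡⟨ cong (λ s → f i + s) (sum-cong-≗ (λ k → f≡0 (punchIn i k) (FinP.punchInᵢ≢i i k))) ⟩
  f i + sum {n} (λ _ → 0ℤ)       ≡⟨ cong (λ s → f i + s) (sum-zero {n}) ⟩
  f i + 0ℤ                       ≡⟨ ℤP.+-identityʳ (f i) ⟩
  f i                            ∎

-- Matrix algebra

fromEntries : ∀ {n} → (Fin n → Fin n → ℤ) → Matrix n
fromEntries f = tabulate λ i → tabulate (f i)

entry-fromEntries : ∀ {n} (f : Fin n → Fin n → ℤ) i j → entry (fromEntries f) i j ≡ f i j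
entry-fromEntries f i j =
  trans (cong (λ row → lookup row j) (VecP.lookup∘tabulate _ i)) (VecP.lookup∘tabulate (f i) j)

lookup-injective : ∀ {A : Set} {n} {xs ys : Vec A n} → (∀ i → lookup xs i ≡ lookup ys i) → xs ≡ ys
lookup-injective {xs = xs} {ys} eq =
  trans (sym (VecP.tabulate∘lookup xs)) (trans (VecP.tabulate-cong eq) (VecP.tabulate∘lookup ys))

matrix-ext : ∀ {n} {M N : Matrix n} → (∀ i j → entry M i j ≡ entry N i j) → M ≡ N
matrix-ext eq = lookup-injective λ i → lookup-injective (eq i)

entry-⊗ : ∀ {n} (A B : Matrix n) i j → entry (A ⊗ B) i j ≡ sum (λ k → entry A i k * entry B k j)
entry-⊗ A B i j = trans (entry-fromEntries _ i j) (sumℤ-tabulate (λ k → entry A i k * entry B k j))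

entry-identity-diag : ∀ {n} (i : Fin n) → entry (identity n) i i ≡ 1ℤ
entry-identity-diag i =
  trans (entry-fromEntries _ i i) (cong (if_then 1ℤ else 0ℤ) (dec-true (i ≟ i) refl))

entry-identity-off : ∀ {n} {i j : Fin n} → i ≢ j → entry (identity n) i j ≡ 0ℤ
entry-identity-off {i = i} {j} i≢j =
  trans (entry-fromEntries _ i j) (cong (if_then 1ℤ else 0ℤ) (dec-false (i ≟ j) i≢j))

sum-identity-row : ∀ {n} (i : Fin n) (f : Fin n → ℤ) → sum (λ k → entry (identity n) i k * f k) ≡ f i
sum-identity-row {suc n} i f = begin
  sum (λ k → entry (identity _) i k * f k) ≡⟨ sum-supported _ i (λ k k≢i → trans (cong (_* f k) (entry-identity-off (k≢i ∘ sym))) (ℤP.*-zeroˡ (f k))) ⟩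
  entry (identity _) i i * f i             ≡⟨ cong (_* f i) (entry-identity-diag i) ⟩
  1ℤ * f i                                 ≡⟨ ℤP.*-identityˡ (f i) ⟩
  f i                                      ∎

sum-identity-column : ∀ {n} (j : Fin n) (f : Fin n → ℤ) → sum (λ k → f k * entry (identity n) k j) ≡ f j
sum-identity-column {suc n} j f = begin
  sum (λ k → f k * entry (identity _) k j) ≡⟨ sum-supported _ j (λ k k≢j → trans (cong (f k *_) (entry-identity-off k≢j)) (ℤP.*-zeroʳ (f k))) ⟩
  f j * entry (identity _) j j             ≡⟨ cong (f j *_) (entry-identity-diag j) ⟩
  f j * 1ℤ                                 ≡⟨ ℤP.*-identityʳ (f j) ⟩
  f j                                      ∎

infixr 7 _·_

_·_ : ∀ {n} → Matrix n → Vector ℤ n → Vector ℤ n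
(M · v) i = sum λ k → entry M i k * v k

column : ∀ {n} → Matrix n → Fin n → Vector ℤ n
column M j k = entry M k j

entry-⊗-column : ∀ {n} (A B : Matrix n) i j → entry (A ⊗ B) i j ≡ (A · column B j) i
entry-⊗-column = entry-⊗

·-cong : ∀ {n} (M : Matrix n) {u v : Vector ℤ n} → u ≗ v → M · u ≗ M · v
·-cong M u≗v i = sum-cong-≗ λ k → cong (entry M i k *_) (u≗v k)

·-zero : ∀ {n} (M : Matrix n) → M · (λ _ → 0ℤ) ≗ λ _ → 0ℤ
·-zero {n} M i = trans (sum-cong-≗ λ k → ℤP.*-zeroʳ (entry M i k)) (sum-zero {n})

identity-· : ∀ {n} (v : Vector ℤ n) → identity n · v ≗ v
identity-· v i = sum-identity-row i v

⊗-· : ∀ {n} (M N : Matrix n) (v : Vector ℤ n) → (M ⊗ N) · v ≗ M · (N · v)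
⊗-· M N v i = begin
  sum (λ k → entry (M ⊗ N) i k * v k)                       ≡⟨ sum-cong-≗ (λ k → cong (_* v k) (entry-⊗ M N i k)) ⟩
  sum (λ k → sum (λ l → entry M i l * entry N l k) * v k)   ≡⟨ sum-cong-≗ (λ k → *-distribʳ-sum (v k) λ l → entry M i l * entry N l k) ⟩
  sum (λ k → sum (λ l → entry M i l * entry N l k * v k))   ≡⟨ ∑-comm (λ k l → entry M i l * entry N l k * v k) ⟩
  sum (λ l → sum (λ k → entry M i l * entry N l k * v k))   ≡⟨ sum-cong-≗ (λ l → sum-cong-≗ λ k → ℤP.*-assoc (entry M i l) (entry N l k) (v k)) ⟩
  sum (λ l → sum (λ k → entry M i l * (entry N l k * v k))) ≡⟨ sum-cong-≗ (λ l → *-distribˡ-sum (entry M i l) λ k → entry N l k * v k) ⟨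
  sum (λ l → entry M i l * (N · v) l)                       ∎

⊗-assoc : ∀ {n} (A B C : Matrix n) → (A ⊗ B) ⊗ C ≡ A ⊗ (B ⊗ C)
⊗-assoc A B C = matrix-ext λ i j → begin
  entry ((A ⊗ B) ⊗ C) i j        ≡⟨ entry-⊗-column (A ⊗ B) C i j ⟩
  ((A ⊗ B) · column C j) i       ≡⟨ ⊗-· A B (column C j) i ⟩
  (A · (B · column C j)) i       ≡⟨ ·-cong A (λ k → entry-⊗-column B C k j) i ⟨
  (A · column (B ⊗ C) j) i       ≡⟨ entry-⊗-column A (B ⊗ C) i j ⟨
  entry (A ⊗ (B ⊗ C)) i j        ∎

⊗-identityˡ : ∀ {n} (A : Matrix n) → identity n ⊗ A ≡ A
⊗-identityˡ {n} A = matrix-ext λ i j → trans (entry-⊗ (identity n) A i j) (sum-identity-row i (column A j))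

⊗-identityʳ : ∀ {n} (A : Matrix n) → A ⊗ identity n ≡ A
⊗-identityʳ {n} A = matrix-ext λ i j → trans (entry-⊗ A (identity n) i j) (sum-identity-column j (entry A i))

linComb : ∀ {m n} → (Fin m → ℤ) → (Fin m → Vector ℤ n) → Vector ℤ n
linComb c f i = sum λ j → c j * f j i

·-linComb : ∀ {m n} (M : Matrix n) (c : Fin m → ℤ) (f : Fin m → Vector ℤ n) →
            M · linComb c f ≗ linComb c (λ j → M · f j)
·-linComb M c f i = begin
  sum (λ k → entry M i k * sum (λ j → c j * f j k))   ≡⟨ sum-cong-≗ (λ k → *-distribˡ-sum (entry M i k) λ j → c j * f j k) ⟩
  sum (λ k → sum (λ j → entry M i k * (c j * f j k))) ≡⟨ ∑-comm (λ k j → entry M i k * (c j * f j k)) ⟩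
  sum (λ j → sum (λ k → entry M i k * (c j * f j k))) ≡⟨ sum-cong-≗ (λ j → sum-cong-≗ λ k → swap (entry M i k) (c j) (f j k)) ⟩
  sum (λ j → sum (λ k → c j * (entry M i k * f j k))) ≡⟨ sum-cong-≗ (λ j → *-distribˡ-sum (c j) λ k → entry M i k * f j k) ⟨
  sum (λ j → c j * (M · f j) i)                       ∎
  where
  swap : ∀ a b c → a * (b * c) ≡ b * (a * c)
  swap = solve-∀

infixl 6 _⊕_ _⊖_
infixr 7 _⊙_

_⊕_ : ∀ {n} → Matrix n → Matrix n → Matrix n
M ⊕ N = fromEntries λ i j → entry M i j + entry N i j

_⊖_ : ∀ {n} → Matrix n → Matrix n → Matrix n
M ⊖ N = fromEntries λ i j → entry M i j - entry N i j

_⊙_ : ∀ {n} → ℤ → Matrix n → Matrix n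
c ⊙ M = fromEntries λ i j → c * entry M i j

entry-⊕ : ∀ {n} (M N : Matrix n) i j → entry (M ⊕ N) i j ≡ entry M i j + entry N i j
entry-⊕ M N = entry-fromEntries _

entry-⊖ : ∀ {n} (M N : Matrix n) i j → entry (M ⊖ N) i j ≡ entry M i j - entry N i j
entry-⊖ M N = entry-fromEntries _

entry-⊙ : ∀ {n} c (M : Matrix n) i j → entry (c ⊙ M) i j ≡ c * entry M i j
entry-⊙ c M = entry-fromEntries _

entry-⊕-⊙-⊕ : ∀ {n} (M : Matrix n) c (N W : Matrix n) i j → entry (M ⊕ c ⊙ N ⊕ W) i j ≡ entry M i j + c * entry N i j + entry W i j
entry-⊕-⊙-⊕ M c N W i j = trans (entry-⊕ (M ⊕ c ⊙ N) W i j)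
  (cong (_+ entry W i j) (trans (entry-⊕ M (c ⊙ N) i j) (cong (λ x → entry M i j + x) (entry-⊙ c N i j))))

⊖-≡0⇒≡ : ∀ {n} {M N : Matrix n} → (∀ i j → entry (M ⊖ N) i j ≡ 0ℤ) → M ≡ N
⊖-≡0⇒≡ {M = M} {N} eq = matrix-ext λ i j → ℤP.i-j≡0⇒i≡j _ _ (trans (sym (entry-⊖ M N i j)) (eq i j))

⊕-distribʳ : ∀ {n} (M N P : Matrix n) → (M ⊕ N) ⊗ P ≡ M ⊗ P ⊕ N ⊗ P
⊕-distribʳ M N P = matrix-ext λ i j → begin
  entry ((M ⊕ N) ⊗ P) i j                   ≡⟨ entry-⊗ (M ⊕ N) P i j ⟩
  sum (λ k → entry (M ⊕ N) i k * P′ k j)    ≡⟨ sum-cong-≗ (λ k → trans (cong (_* P′ k j) (entry-⊕ M N i k)) (ℤP.*-distribʳ-+ (P′ k j) (M′ i k) (N′ i k))) ⟩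
  sum (λ k → M′ i k * P′ k j + N′ i k * P′ k j)                   ≡⟨ ∑-distrib-+ (λ k → M′ i k * P′ k j) (λ k → N′ i k * P′ k j) ⟩
  sum (λ k → M′ i k * P′ k j) + sum (λ k → N′ i k * P′ k j)       ≡⟨ cong₂ _+_ (entry-⊗ M P i j) (entry-⊗ N P i j) ⟨
  entry (M ⊗ P) i j + entry (N ⊗ P) i j     ≡⟨ entry-⊕ (M ⊗ P) (N ⊗ P) i j ⟨
  entry (M ⊗ P ⊕ N ⊗ P) i j                 ∎
  where M′ = entry M; N′ = entry N; P′ = entry P

⊕-distribˡ : ∀ {n} (P M N : Matrix n) → P ⊗ (M ⊕ N) ≡ P ⊗ M ⊕ P ⊗ N
⊕-distribˡ P M N = matrix-ext λ i j → begin
  entry (P ⊗ (M ⊕ N)) i j                   ≡⟨ entry-⊗ P (M ⊕ N) i j ⟩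
  sum (λ k → P′ i k * entry (M ⊕ N) k j)    ≡⟨ sum-cong-≗ (λ k → trans (cong (P′ i k *_) (entry-⊕ M N k j)) (ℤP.*-distribˡ-+ (P′ i k) _ _)) ⟩
  sum (λ k → P′ i k * M′ k j + P′ i k * N′ k j)                   ≡⟨ ∑-distrib-+ (λ k → P′ i k * M′ k j) (λ k → P′ i k * N′ k j) ⟩
  sum (λ k → P′ i k * M′ k j) + sum (λ k → P′ i k * N′ k j)       ≡⟨ cong₂ _+_ (entry-⊗ P M i j) (entry-⊗ P N i j) ⟨
  entry (P ⊗ M) i j + entry (P ⊗ N) i j     ≡⟨ entry-⊕ (P ⊗ M) (P ⊗ N) i j ⟨
  entry (P ⊗ M ⊕ P ⊗ N) i j                 ∎
  where M′ = entry M; N′ = entry N; P′ = entry P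

⊖-distribʳ : ∀ {n} (M N P : Matrix n) → (M ⊖ N) ⊗ P ≡ M ⊗ P ⊖ N ⊗ P
⊖-distribʳ M N P = matrix-ext λ i j → begin
  entry ((M ⊖ N) ⊗ P) i j                   ≡⟨ entry-⊗ (M ⊖ N) P i j ⟩
  sum (λ k → entry (M ⊖ N) i k * P′ k j)    ≡⟨ sum-cong-≗ (λ k → trans (cong (_* P′ k j) (entry-⊖ M N i k)) ([y-z]x≈yx-zx (P′ k j) (M′ i k) (N′ i k))) ⟩
  sum (λ k → M′ i k * P′ k j - N′ i k * P′ k j)                   ≡⟨ sum-distrib-- (λ k → M′ i k * P′ k j) (λ k → N′ i k * P′ k j) ⟩
  sum (λ k → M′ i k * P′ k j) - sum (λ k → N′ i k * P′ k j)       ≡⟨ cong₂ _-_ (entry-⊗ M P i j) (entry-⊗ N P i j) ⟨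
  entry (M ⊗ P) i j - entry (N ⊗ P) i j     ≡⟨ entry-⊖ (M ⊗ P) (N ⊗ P) i j ⟨
  entry (M ⊗ P ⊖ N ⊗ P) i j                 ∎
  where M′ = entry M; N′ = entry N; P′ = entry P

⊖-distribˡ : ∀ {n} (P M N : Matrix n) → P ⊗ (M ⊖ N) ≡ P ⊗ M ⊖ P ⊗ N
⊖-distribˡ P M N = matrix-ext λ i j → begin
  entry (P ⊗ (M ⊖ N)) i j                   ≡⟨ entry-⊗ P (M ⊖ N) i j ⟩
  sum (λ k → P′ i k * entry (M ⊖ N) k j)    ≡⟨ sum-cong-≗ (λ k → trans (cong (P′ i k *_) (entry-⊖ M N k j)) (x[y-z]≈xy-xz (P′ i k) _ _)) ⟩
  sum (λ k → P′ i k * M′ k j - P′ i k * N′ k j)                   ≡⟨ sum-distrib-- (λ k → P′ i k * M′ k j) (λ k → P′ i k * N′ k j) ⟩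
  sum (λ k → P′ i k * M′ k j) - sum (λ k → P′ i k * N′ k j)       ≡⟨ cong₂ _-_ (entry-⊗ P M i j) (entry-⊗ P N i j) ⟨
  entry (P ⊗ M) i j - entry (P ⊗ N) i j     ≡⟨ entry-⊖ (P ⊗ M) (P ⊗ N) i j ⟨
  entry (P ⊗ M ⊖ P ⊗ N) i j                 ∎
  where M′ = entry M; N′ = entry N; P′ = entry P

⊙-⊗ : ∀ {n} c (M N : Matrix n) → (c ⊙ M) ⊗ N ≡ c ⊙ (M ⊗ N)
⊙-⊗ c M N = matrix-ext λ i j → begin
  entry ((c ⊙ M) ⊗ N) i j                   ≡⟨ entry-⊗ (c ⊙ M) N i j ⟩
  sum (λ k → entry (c ⊙ M) i k * N′ k j)    ≡⟨ sum-cong-≗ (λ k → trans (cong (_* N′ k j) (entry-⊙ c M i k)) (ℤP.*-assoc c _ _)) ⟩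
  sum (λ k → c * (M′ i k * N′ k j))         ≡⟨ *-distribˡ-sum c (λ k → M′ i k * N′ k j) ⟨
  c * sum (λ k → M′ i k * N′ k j)           ≡⟨ cong (c *_) (entry-⊗ M N i j) ⟨
  c * entry (M ⊗ N) i j                     ≡⟨ entry-⊙ c (M ⊗ N) i j ⟨
  entry (c ⊙ (M ⊗ N)) i j                   ∎
  where M′ = entry M; N′ = entry N

pow-+ : ∀ {n} (A : Matrix n) a b → pow A (a ℕ.+ b) ≡ pow A a ⊗ pow A b
pow-+ A a zero    = trans (cong (pow A) (ℕP.+-identityʳ a)) (sym (⊗-identityʳ (pow A a)))
pow-+ A a (suc b) = begin
  pow A (a ℕ.+ suc b)         ≡⟨ cong (pow A) (ℕP.+-suc a b) ⟩
  pow A (a ℕ.+ b) ⊗ A         ≡⟨ cong (_⊗ A) (pow-+ A a b) ⟩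
  (pow A a ⊗ pow A b) ⊗ A     ≡⟨ ⊗-assoc (pow A a) (pow A b) A ⟩
  pow A a ⊗ pow A (suc b)     ∎

pow-* : ∀ {n} (A : Matrix n) a b → pow A (a ℕ.* b) ≡ pow (pow A a) b
pow-* A a zero    = cong (pow A) (ℕP.*-zeroʳ a)
pow-* A a (suc b) = begin
  pow A (a ℕ.* suc b)         ≡⟨ cong (pow A) (trans (ℕP.*-suc a b) (ℕP.+-comm a _)) ⟩
  pow A (a ℕ.* b ℕ.+ a)       ≡⟨ pow-+ A (a ℕ.* b) a ⟩
  pow A (a ℕ.* b) ⊗ pow A a   ≡⟨ cong (_⊗ pow A a) (pow-* A a b) ⟩
  pow (pow A a) (suc b)       ∎

pow-·-+ : ∀ {n} (A : Matrix n) a b (v : Vector ℤ n) → pow A (a ℕ.+ b) · v ≗ pow A a · pow A b · v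
pow-·-+ A a b v i = trans (cong (λ M → (M · v) i) (pow-+ A a b)) (⊗-· (pow A a) (pow A b) v i)

-- Linear dependence and kernels of powers

Dependent : ∀ {m n} → (Fin m → Vector ℤ n) → Set
Dependent f = ∃ λ c → (∃ λ j → c j ≢ 0ℤ) × linComb c f ≗ λ _ → 0ℤ

product≢0 : ∀ {x y} → x ≢ 0ℤ → y ≢ 0ℤ → x * y ≢ 0ℤ
product≢0 {x} x≢0 y≢0 xy≡0 = [ x≢0 , y≢0 ]′ (ℤP.i*j≡0⇒i≡0∨j≡0 x xy≡0)

-- Gaussian elimination of the first coordinate against the pivot vector f r.
dependent-by-pivot : ∀ {m n} (f : Fin (suc m) → Vector ℤ (suc n)) (r : Fin (suc m)) → f r zero ≢ 0ℤ →
  Dependent (λ s i → f r zero * f (punchIn r s) (suc i) - f (punchIn r s) zero * f r (suc i)) →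
  Dependent f
dependent-by-pivot f r x≢0 (c′ , (j , c′j≢0) , c′-rel) =
  c , (punchIn r j , c-nontrivial) , c-rel
  where
  x = f r zero
  f′ = f ∘ punchIn r
  F = linComb c′ f′
  c : Fin (suc _) → ℤ
  c = insertAt (λ s → x * c′ s) r (- F zero)
  c-nontrivial : c (punchIn r j) ≢ 0ℤ
  c-nontrivial = subst (_≢ 0ℤ) (sym (insertAt-punchIn _ r _ j)) (product≢0 x≢0 c′j≢0)
  eliminated : ∀ i → linComb c′ (λ s i → x * f′ s (suc i) - f′ s zero * f r (suc i)) i ≡ x * F (suc i) - F zero * f r (suc i)
  eliminated i = begin
    sum (λ s → c′ s * (x * f′ s (suc i) - f′ s zero * f r (suc i)))           ≡⟨ sum-cong-≗ (λ s → distribute x (f r (suc i)) (c′ s) (f′ s (suc i)) (f′ s zero)) ⟩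
    sum (λ s → x * (c′ s * f′ s (suc i)) - c′ s * f′ s zero * f r (suc i))   ≡⟨ sum-distrib-- (λ s → x * (c′ s * f′ s (suc i))) (λ s → c′ s * f′ s zero * f r (suc i)) ⟩
    sum (λ s → x * (c′ s * f′ s (suc i))) - sum (λ s → c′ s * f′ s zero * f r (suc i))
      ≡⟨ cong₂ _-_ (*-distribˡ-sum x (λ s → c′ s * f′ s (suc i))) (*-distribʳ-sum (f r (suc i)) (λ s → c′ s * f′ s zero)) ⟨
    x * F (suc i) - F zero * f r (suc i)                                      ∎
    where
    distribute : ∀ x y c a b → c * (x * a - b * y) ≡ x * (c * a) - c * b * y
    distribute = solve-∀
  cancel : ∀ i → - F zero * f r i + x * F i ≡ 0ℤ
  cancel zero    = cancels (F zero) x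
    where cancels : ∀ a x → - a * x + x * a ≡ 0ℤ
          cancels = solve-∀
  cancel (suc i) = trans (reorder (F zero) (f r (suc i)) (x * F (suc i))) (trans (sym (eliminated i)) (c′-rel i))
    where reorder : ∀ a y t → - a * y + t ≡ t - a * y
          reorder = solve-∀
  c-rel : linComb c f ≗ λ _ → 0ℤ
  c-rel i = begin
    sum (λ k → c k * f k i)                               ≡⟨ sum-remove {i = r} (λ k → c k * f k i) ⟩
    c r * f r i + sum (λ s → c (punchIn r s) * f′ s i)    ≡⟨ cong₂ _+_ (cong (_* f r i) (insertAt-lookup _ r _)) (sum-cong-≗ λ s → cong (_* f′ s i) (insertAt-punchIn _ r _ s)) ⟩
    - F zero * f r i + sum (λ s → x * c′ s * f′ s i)      ≡⟨ cong (λ t → - F zero * f r i + t) (trans (sum-cong-≗ λ s → ℤP.*-assoc x (c′ s) (f′ s i)) (sym (*-distribˡ-sum x λ s → c′ s * f′ s i))) ⟩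
    - F zero * f r i + x * F i                            ≡⟨ cancel i ⟩
    0ℤ                                                    ∎

more-vectors-than-dimension⇒dependent : ∀ {m n} → n < m → (f : Fin m → Vector ℤ n) → Dependent f
more-vectors-than-dimension⇒dependent {suc m} {zero} _ f = (λ _ → 1ℤ) , (zero , λ ()) , λ ()
more-vectors-than-dimension⇒dependent {suc m} {suc n} (s≤s n<m) f with all? (λ j → f j zero ℤ.≟ 0ℤ)
... | yes heads≡0 =
  let c , nontrivial , rel = more-vectors-than-dimension⇒dependent (ℕP.m<n⇒m<1+n n<m) (λ j i → f j (suc i))
      rel′ : linComb c f ≗ λ _ → 0ℤ
      rel′ = λ { zero → trans (sum-cong-≗ λ j → trans (cong (c j *_) (heads≡0 j)) (ℤP.*-zeroʳ (c j))) (sum-zero {suc m})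
               ; (suc i) → rel i }
  in c , nontrivial , rel′
... | no ¬heads≡0 =
  let r , x≢0 = ¬∀⟶∃¬ (suc m) _ (λ j → f j zero ℤ.≟ 0ℤ) ¬heads≡0
  in dependent-by-pivot f r x≢0 (more-vectors-than-dimension⇒dependent n<m _)

pow-suc-· : ∀ {n} (A : Matrix n) k (w : Vector ℤ n) → pow A (suc k) · w ≗ pow A k · A · w
pow-suc-· A k = ⊗-· (pow A k) A

-- Applying A^m to the relation kills every term but c₀ A^m w; if c₀ = 0 the relation shifts to the orbit of A w.
vanishing-orbit : ∀ {n} (A : Matrix n) m (w : Vector ℤ n) →
  Dependent (λ (j : Fin (suc m)) → pow A (toℕ j) · w) →
  pow A (suc m) · w ≗ (λ _ → 0ℤ) → pow A m · w ≗ λ _ → 0ℤ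
vanishing-orbit A m w (c , nontrivial , rel) Aᵐ⁺¹w≡0 i with c zero ℤ.≟ 0ℤ
... | no c₀≢0 = [ (λ c₀≡0 → contradiction c₀≡0 c₀≢0) , id ]′ (ℤP.i*j≡0⇒i≡0∨j≡0 (c zero) leading≡0)
  where
  higher≡0 : ∀ t → (pow A m · pow A (suc (toℕ t)) · w) i ≡ 0ℤ
  higher≡0 t = begin
    (pow A m · pow A (suc (toℕ t)) · w) i   ≡⟨ pow-·-+ A m (suc (toℕ t)) w i ⟨
    (pow A (m ℕ.+ suc (toℕ t)) · w) i       ≡⟨ cong (λ e → (pow A e · w) i) (ℕP.+-comm m (suc (toℕ t))) ⟩
    (pow A (suc (toℕ t) ℕ.+ m) · w) i       ≡⟨ cong (λ e → (pow A e · w) i) (sym (ℕP.+-suc (toℕ t) m)) ⟩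
    (pow A (toℕ t ℕ.+ suc m) · w) i         ≡⟨ pow-·-+ A (toℕ t) (suc m) w i ⟩
    (pow A (toℕ t) · pow A (suc m) · w) i   ≡⟨ ·-cong (pow A (toℕ t)) Aᵐ⁺¹w≡0 i ⟩
    (pow A (toℕ t) · (λ _ → 0ℤ)) i          ≡⟨ ·-zero (pow A (toℕ t)) i ⟩
    0ℤ                                      ∎
  tail≡0 : sum (λ t → c (suc t) * (pow A m · pow A (suc (toℕ t)) · w) i) ≡ 0ℤ
  tail≡0 = trans (sum-cong-≗ λ t → trans (cong (c (suc t) *_) (higher≡0 t)) (ℤP.*-zeroʳ (c (suc t)))) (sum-zero {m})
  leading≡0 : c zero * (pow A m · w) i ≡ 0ℤ
  leading≡0 = begin
    c zero * (pow A m · w) i                            ≡⟨ ℤP.+-identityʳ _ ⟨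
    c zero * (pow A m · w) i + 0ℤ                       ≡⟨ cong₂ _+_ (cong (c zero *_) (·-cong (pow A m) (identity-· w) i)) tail≡0 ⟨
    linComb c (λ j → pow A m · pow A (toℕ j) · w) i     ≡⟨ ·-linComb (pow A m) c (λ j → pow A (toℕ j) · w) i ⟨
    (pow A m · linComb c (λ j → pow A (toℕ j) · w)) i   ≡⟨ ·-cong (pow A m) rel i ⟩
    (pow A m · (λ _ → 0ℤ)) i                            ≡⟨ ·-zero (pow A m) i ⟩
    0ℤ                                                  ∎
vanishing-orbit A zero    w (c , (zero  , c₀≢0) , _) _ i | yes c₀≡0 = contradiction c₀≡0 c₀≢0
vanishing-orbit A (suc m) w (c , (zero  , c₀≢0) , _) _ i | yes c₀≡0 = contradiction c₀≡0 c₀≢0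
vanishing-orbit A (suc m) w (c , (suc j , cj≢0) , rel) Aᵐ⁺²w≡0 i | yes c₀≡0 =
  trans (pow-suc-· A m w i) (vanishing-orbit A m (A · w) (c ∘ suc , (j , cj≢0) , shifted) shifted-vanishes i)
  where
  shifted : linComb (c ∘ suc) (λ t → pow A (toℕ t) · A · w) ≗ λ _ → 0ℤ
  shifted i = begin
    sum (λ t → c (suc t) * (pow A (toℕ t) · A · w) i)   ≡⟨ sum-cong-≗ (λ t → cong (c (suc t) *_) (pow-suc-· A (toℕ t) w i)) ⟨
    rest                                                ≡⟨ ℤP.+-identityˡ rest ⟨
    0ℤ + rest                                           ≡⟨ cong (_+ rest) head≡0 ⟨
    c zero * (pow A 0 · w) i + rest                     ≡⟨ rel i ⟩
    0ℤ                                                  ∎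
    where
    rest = sum (λ t → c (suc t) * (pow A (suc (toℕ t)) · w) i)
    head≡0 : c zero * (pow A 0 · w) i ≡ 0ℤ
    head≡0 = trans (cong (_* (pow A 0 · w) i) c₀≡0) (ℤP.*-zeroˡ ((pow A 0 · w) i))
  shifted-vanishes : pow A (suc m) · A · w ≗ λ _ → 0ℤ
  shifted-vanishes i = trans (sym (pow-suc-· A (suc m) w i)) (Aᵐ⁺²w≡0 i)

module _ {n} (A : Matrix n) where

  kernel-pow-suc-dim : ∀ (w : Vector ℤ n) → pow A (suc n) · w ≗ (λ _ → 0ℤ) → pow A n · w ≗ λ _ → 0ℤ
  kernel-pow-suc-dim w =
    vanishing-orbit A n w (more-vectors-than-dimension⇒dependent (ℕP.n<1+n n) λ j → pow A (toℕ j) · w)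

  kernel-pow-dim+ : ∀ k (w : Vector ℤ n) → pow A (n ℕ.+ k) · w ≗ (λ _ → 0ℤ) → pow A n · w ≗ λ _ → 0ℤ
  kernel-pow-dim+ zero    w Aⁿ⁺⁰w≡0 i = trans (cong (λ e → (pow A e · w) i) (sym (ℕP.+-identityʳ n))) (Aⁿ⁺⁰w≡0 i)
  kernel-pow-dim+ (suc k) w Aⁿ⁺ᵏ⁺¹w≡0 = kernel-pow-suc-dim w λ i →
    trans (pow-suc-· A n w i) (kernel-pow-dim+ k (A · w) (λ i → begin
      (pow A (n ℕ.+ k) · A · w) i   ≡⟨ pow-suc-· A (n ℕ.+ k) w i ⟨
      (pow A (suc (n ℕ.+ k)) · w) i ≡⟨ cong (λ e → (pow A e · w) i) (ℕP.+-suc n k) ⟨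
      (pow A (n ℕ.+ suc k) · w) i   ≡⟨ Aⁿ⁺ᵏ⁺¹w≡0 i ⟩
      0ℤ                            ∎) i)

  kernel-pow⊆kernel-pow-dim : ∀ k (w : Vector ℤ n) → pow A k · w ≗ (λ _ → 0ℤ) → pow A n · w ≗ λ _ → 0ℤ
  kernel-pow⊆kernel-pow-dim k w Aᵏw≡0 = kernel-pow-dim+ k w λ i → begin
    (pow A (n ℕ.+ k) · w) i        ≡⟨ pow-·-+ A n k w i ⟩
    (pow A n · pow A k · w) i      ≡⟨ ·-cong (pow A n) Aᵏw≡0 i ⟩
    (pow A n · (λ _ → 0ℤ)) i       ≡⟨ ·-zero (pow A n) i ⟩
    0ℤ                             ∎

⊗-identity-⊖ : ∀ {n} (M E : Matrix n) → M ⊗ (identity n ⊖ E) ≡ M ⊖ M ⊗ E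
⊗-identity-⊖ {n} M E = trans (⊖-distribˡ M (identity n) E) (cong (_⊖ M ⊗ E) (⊗-identityʳ M))

-- A^k E = A^k says that every column of I - E lies in the kernel of A^k.
pow-absorbs⇒pow-dim-absorbs : ∀ {n} (A : Matrix n) k (E : Matrix n) → pow A k ⊗ E ≡ pow A k → pow A n ⊗ E ≡ pow A n
pow-absorbs⇒pow-dim-absorbs {n} A k E AᵏE≡Aᵏ = sym (⊖-≡0⇒≡ λ i l → begin
  entry (pow A n ⊖ pow A n ⊗ E) i l         ≡⟨ entry-⊖⊗ (pow A n) i l ⟩
  (pow A n · column (identity n ⊖ E) l) i   ≡⟨ kernel-pow⊆kernel-pow-dim A k _ (column-in-kernel l) i ⟩
  0ℤ                                        ∎)
  where
  entry-⊖⊗ : ∀ M i l → entry (M ⊖ M ⊗ E) i l ≡ (M · column (identity n ⊖ E) l) i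
  entry-⊖⊗ M i l = trans (cong (λ N → entry N i l) (sym (⊗-identity-⊖ M E))) (entry-⊗-column M (identity n ⊖ E) i l)
  column-in-kernel : ∀ l → pow A k · column (identity n ⊖ E) l ≗ λ _ → 0ℤ
  column-in-kernel l i = begin
    (pow A k · column (identity n ⊖ E) l) i   ≡⟨ entry-⊖⊗ (pow A k) i l ⟨
    entry (pow A k ⊖ pow A k ⊗ E) i l         ≡⟨ cong (λ M → entry (pow A k ⊖ M) i l) AᵏE≡Aᵏ ⟩
    entry (pow A k ⊖ pow A k) i l             ≡⟨ entry-⊖ (pow A k) (pow A k) i l ⟩
    entry (pow A k) i l - entry (pow A k) i l ≡⟨ ℤP.+-inverseʳ (entry (pow A k) i l) ⟩
    0ℤ                                        ∎

-- Divisibility by powers of 3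

infix 4 _∣ᴹ_

_∣ᴹ_ : ∀ {n} → ℤ → Matrix n → Set
d ∣ᴹ M = ∀ i j → d ∣ entry M i j

∣-sum : ∀ {n} {d} (f : Fin n → ℤ) → (∀ k → d ∣ f k) → d ∣ sum f
∣-sum {zero}  f d∣f = divides 0ℤ refl
∣-sum {suc n} f d∣f = ∣m∣n⇒∣m+n (d∣f zero) (∣-sum (f ∘ suc) (d∣f ∘ suc))

∣-* : ∀ {a b x y} → a ∣ x → b ∣ y → a * b ∣ x * y
∣-* {a} {b} {x} a∣x b∣y = ∣-trans (*-monoˡ-∣ b a∣x) (*-monoʳ-∣ x b∣y)

∣ᴹ-⊗ : ∀ {n} {a b} {M N : Matrix n} → a ∣ᴹ M → b ∣ᴹ N → a * b ∣ᴹ M ⊗ N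
∣ᴹ-⊗ {M = M} {N} a∣M b∣N i j =
  subst (_ ∣_) (sym (entry-⊗ M N i j)) (∣-sum _ λ k → ∣-* (a∣M i k) (b∣N k j))

∣ᴹ-⊗ˡ : ∀ {n} {a} {M : Matrix n} (N : Matrix n) → a ∣ᴹ M → a ∣ᴹ M ⊗ N
∣ᴹ-⊗ˡ {M = M} N a∣M i j =
  subst (_ ∣_) (sym (entry-⊗ M N i j)) (∣-sum _ λ k → ∣m⇒∣m*n (entry N k j) (a∣M i k))

∣ᴹ-⊗ʳ : ∀ {n} {b} (M : Matrix n) {N : Matrix n} → b ∣ᴹ N → b ∣ᴹ M ⊗ N
∣ᴹ-⊗ʳ M {N} b∣N i j =
  subst (_ ∣_) (sym (entry-⊗ M N i j)) (∣-sum _ λ k → ∣n⇒∣m*n (entry M i k) (b∣N k j))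

3-prime : Prime 3
3-prime = from-yes (prime? 3)

3∣*-coprime : ∀ {c q} → + 3 ∣ c * q → ¬ 3 ℕ.∣ ℤ.∣ c ∣ → + 3 ∣ q
3∣*-coprime {c} {q} 3∣cq 3∤c with euclidsLemma ℤ.∣ c ∣ ℤ.∣ q ∣ 3-prime (subst (3 ℕ.∣_) (ℤP.abs-* c q) (∣⇒∣ᵤ 3∣cq))
... | inj₁ 3∣c = contradiction 3∣c 3∤c
... | inj₂ 3∣q = ∣ᵤ⇒∣ 3∣q

n<3^n : ∀ n → n < 3 ^ n
n<3^n zero    = s≤s z≤n
n<3^n (suc n) = ℕP.≤-trans (ℕP.+-mono-≤ (ℕP.m^n>0 3 n) (n<3^n n)) (ℕP.+-monoʳ-≤ (3 ^ n) (ℕP.m≤m+n (3 ^ n) _))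

divisible-by-all-powers-of-3⇒0 : ∀ y → (∀ k → + (3 ^ suc k) ∣ y) → y ≡ 0ℤ
divisible-by-all-powers-of-3⇒0 y 3ᵏ∣y with ℤ.∣ y ∣ in ∣y∣≡
... | zero  = ℤP.∣i∣≡0⇒i≡0 ∣y∣≡
... | suc a = contradiction (ℕ.∣⇒≤ (subst (3 ^ suc a ℕ.∣_) ∣y∣≡ (∣⇒∣ᵤ (3ᵏ∣y a)))) (ℕP.<⇒≱ (n<3^n (suc a)))

3∣3^[1+k] : ∀ k → + 3 ∣ + (3 ^ suc k)
3∣3^[1+k] k = divides (+ (3 ^ k)) (trans (ℤP.pos-* 3 (3 ^ k)) (ℤP.*-comm (+ 3) (+ (3 ^ k))))

3*3^[1+k]≡3^[2+k] : ∀ k → + 3 * + (3 ^ suc k) ≡ + (3 ^ suc (suc k))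
3*3^[1+k]≡3^[2+k] k = sym (ℤP.pos-* 3 (3 ^ suc k))

∣-refine-coprime : ∀ t {c y} .{{_ : ℤ.NonZero t}} → + 3 ∣ t → t ∣ y → t * t ∣ c * y → ¬ 3 ℕ.∣ ℤ.∣ c ∣ → + 3 * t ∣ y
∣-refine-coprime t {c} {y} 3∣t (divides q y≡qt) t²∣cy 3∤c = subst (+ 3 * t ∣_) (sym y≡qt) (*-monoˡ-∣ t 3∣q)
  where
  t∣cq : t ∣ c * q
  t∣cq = *-cancelʳ-∣ t (subst (t * t ∣_) (trans (cong (c *_) y≡qt) (sym (ℤP.*-assoc c q t))) t²∣cy)
  3∣q : + 3 ∣ q
  3∣q = 3∣*-coprime {c} (∣-trans 3∣t t∣cq) 3∤c

∣-refine-cube : ∀ {t y} → + 3 ∣ t → + 3 * (t * t) ∣ + 3 * y → + 3 * t ∣ y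
∣-refine-cube {t} 3∣t 3t²∣3y = ∣-trans (*-monoˡ-∣ t 3∣t) (*-cancelˡ-∣ (+ 3) 3t²∣3y)

-- Minkowski's lemma

module Minkowski {n} {E : Matrix n} (E-idem : E ⊗ E ≡ E) where

  InCorner : Matrix n → Set
  InCorner B = B ⊗ E ≡ B × E ⊗ B ≡ B

  pow-inCorner : ∀ {B} k → InCorner B → InCorner (pow B (suc k))
  pow-inCorner {B} k (BE≡B , EB≡B) = right k , left k
    where
    right : ∀ k → pow B (suc k) ⊗ E ≡ pow B (suc k)
    right k = trans (⊗-assoc (pow B k) B E) (cong (pow B k ⊗_) BE≡B)
    left : ∀ k → E ⊗ pow B (suc k) ≡ pow B (suc k)
    left zero    = trans (cong (E ⊗_) (⊗-identityˡ B)) (trans EB≡B (sym (⊗-identityˡ B)))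
    left (suc k) = trans (sym (⊗-assoc E (pow B (suc k)) B)) (cong (_⊗ B) (left k))

  module Expansion {B : Matrix n} (B∈corner : InCorner B) where

    BE≡B : B ⊗ E ≡ B
    BE≡B = proj₁ B∈corner

    EB≡B : E ⊗ B ≡ B
    EB≡B = proj₂ B∈corner

    Y : Matrix n
    Y = B ⊖ E

    B≡E⊕Y : B ≡ E ⊕ Y
    B≡E⊕Y = matrix-ext λ i j → sym (begin
      entry (E ⊕ Y) i j                            ≡⟨ entry-⊕ E Y i j ⟩
      entry E i j + entry Y i j                    ≡⟨ cong (λ y → entry E i j + y) (entry-⊖ B E i j) ⟩
      entry E i j + (entry B i j - entry E i j)    ≡⟨ cancel (entry E i j) (entry B i j) ⟩
      entry B i j                                  ∎)
      where
      cancel : ∀ e b → e + (b - e) ≡ b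
      cancel = solve-∀

    ⊗B≡⊕⊗Y : ∀ X → X ⊗ E ≡ X → X ⊗ B ≡ X ⊕ X ⊗ Y
    ⊗B≡⊕⊗Y X XE≡X = trans (cong (X ⊗_) B≡E⊕Y) (trans (⊕-distribˡ X E Y) (cong (_⊕ X ⊗ Y) XE≡X))

    YE≡Y : Y ⊗ E ≡ Y
    YE≡Y = trans (⊖-distribʳ B E E) (cong₂ _⊖_ BE≡B E-idem)

    -- Z m ⊗ Y² collects the terms of degree ≥ 2 in the binomial expansion of (E + Y)^(m+1).
    Z : ℕ → Matrix n
    Z zero    = 0ℤ ⊙ identity n
    Z (suc m) = (+ suc m) ⊙ identity n ⊕ Z m ⊕ Z m ⊗ Y

    Z-step : ∀ m → Z (suc m) ⊗ (Y ⊗ Y) ≡ (+ suc m) ⊙ (Y ⊗ Y) ⊕ Z m ⊗ (Y ⊗ Y) ⊕ (Z m ⊗ (Y ⊗ Y)) ⊗ Y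
    Z-step m = begin
      ((+ suc m) ⊙ identity n ⊕ Z m ⊕ Z m ⊗ Y) ⊗ (Y ⊗ Y)
        ≡⟨ trans (⊕-distribʳ ((+ suc m) ⊙ identity n ⊕ Z m) (Z m ⊗ Y) (Y ⊗ Y))
             (cong (_⊕ (Z m ⊗ Y) ⊗ (Y ⊗ Y)) (⊕-distribʳ ((+ suc m) ⊙ identity n) (Z m) (Y ⊗ Y))) ⟩
      ((+ suc m) ⊙ identity n) ⊗ (Y ⊗ Y) ⊕ Z m ⊗ (Y ⊗ Y) ⊕ (Z m ⊗ Y) ⊗ (Y ⊗ Y)
        ≡⟨ cong₂ (λ P Q → P ⊕ Z m ⊗ (Y ⊗ Y) ⊕ Q) (trans (⊙-⊗ (+ suc m) (identity n) (Y ⊗ Y)) (cong ((+ suc m) ⊙_) (⊗-identityˡ (Y ⊗ Y)))) cube ⟩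
      (+ suc m) ⊙ (Y ⊗ Y) ⊕ Z m ⊗ (Y ⊗ Y) ⊕ (Z m ⊗ (Y ⊗ Y)) ⊗ Y
        ∎
      where
      cube : (Z m ⊗ Y) ⊗ (Y ⊗ Y) ≡ (Z m ⊗ (Y ⊗ Y)) ⊗ Y
      cube = trans (⊗-assoc (Z m) Y (Y ⊗ Y))
               (trans (cong (Z m ⊗_) (sym (⊗-assoc Y Y Y))) (sym (⊗-assoc (Z m) (Y ⊗ Y) Y)))

    pow-expansion : ∀ m → pow B (suc m) ≡ E ⊕ (+ suc m) ⊙ Y ⊕ Z m ⊗ (Y ⊗ Y)
    pow-expansion zero = matrix-ext λ i j → sym (begin
      entry (E ⊕ 1ℤ ⊙ Y ⊕ Z zero ⊗ (Y ⊗ Y)) i j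
        ≡⟨ entry-⊕-⊙-⊕ E 1ℤ Y (Z zero ⊗ (Y ⊗ Y)) i j ⟩
      entry E i j + 1ℤ * entry Y i j + entry (Z zero ⊗ (Y ⊗ Y)) i j
        ≡⟨ cong (λ w → entry E i j + 1ℤ * entry Y i j + w) (trans (cong (λ M → entry M i j) (⊙-⊗ 0ℤ (identity n) (Y ⊗ Y))) (entry-⊙ 0ℤ (identity n ⊗ (Y ⊗ Y)) i j)) ⟩
      entry E i j + 1ℤ * entry Y i j + 0ℤ * entry (identity n ⊗ (Y ⊗ Y)) i j
        ≡⟨ simplify (entry E i j) (entry Y i j) (entry (identity n ⊗ (Y ⊗ Y)) i j) ⟩
      entry E i j + entry Y i j
        ≡⟨ entry-⊕ E Y i j ⟨
      entry (E ⊕ Y) i j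
        ≡⟨ cong (λ M → entry M i j) (trans (sym B≡E⊕Y) (sym (⊗-identityˡ B))) ⟩
      entry (pow B 1) i j
        ∎)
      where
      simplify : ∀ e y z → e + 1ℤ * y + 0ℤ * z ≡ e + y
      simplify = solve-∀
    pow-expansion (suc m) = begin
      pow B (suc m) ⊗ B                                 ≡⟨ cong (_⊗ B) (pow-expansion m) ⟩
      (E ⊕ r ⊙ Y ⊕ W) ⊗ B                               ≡⟨ trans (⊕-distribʳ (E ⊕ r ⊙ Y) W B) (cong (_⊕ W ⊗ B) (⊕-distribʳ E (r ⊙ Y) B)) ⟩
      E ⊗ B ⊕ (r ⊙ Y) ⊗ B ⊕ W ⊗ B                       ≡⟨ cong₂ _⊕_ (cong₂ _⊕_ EB≡B (trans (⊙-⊗ r Y B) (cong (r ⊙_) (⊗B≡⊕⊗Y Y YE≡Y)))) (⊗B≡⊕⊗Y W WE≡W) ⟩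
      B ⊕ r ⊙ (Y ⊕ Y ⊗ Y) ⊕ (W ⊕ W ⊗ Y)                 ≡⟨ matrix-ext collect ⟩
      E ⊕ (+ suc (suc m)) ⊙ Y ⊕ (r ⊙ (Y ⊗ Y) ⊕ W ⊕ W ⊗ Y) ≡⟨ cong (λ P → E ⊕ (+ suc (suc m)) ⊙ Y ⊕ P) (Z-step m) ⟨
      E ⊕ (+ suc (suc m)) ⊙ Y ⊕ Z (suc m) ⊗ (Y ⊗ Y)     ∎
      where
      r = + suc m
      W = Z m ⊗ (Y ⊗ Y)
      WE≡W : W ⊗ E ≡ W
      WE≡W = trans (⊗-assoc (Z m) (Y ⊗ Y) E) (cong (Z m ⊗_) (trans (⊗-assoc Y Y E) (cong (Y ⊗_) YE≡Y)))
      collect : ∀ i j → entry (B ⊕ r ⊙ (Y ⊕ Y ⊗ Y) ⊕ (W ⊕ W ⊗ Y)) i j ≡ entry (E ⊕ (+ suc (suc m)) ⊙ Y ⊕ (r ⊙ (Y ⊗ Y) ⊕ W ⊕ W ⊗ Y)) i j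
      collect i j
        rewrite entry-⊕-⊙-⊕ B r (Y ⊕ Y ⊗ Y) (W ⊕ W ⊗ Y) i j
              | entry-⊕-⊙-⊕ E (+ suc (suc m)) Y (r ⊙ (Y ⊗ Y) ⊕ W ⊕ W ⊗ Y) i j
              | entry-⊕ Y (Y ⊗ Y) i j | entry-⊕ W (W ⊗ Y) i j
              | entry-⊕ (r ⊙ (Y ⊗ Y) ⊕ W) (W ⊗ Y) i j | entry-⊕ (r ⊙ (Y ⊗ Y)) W i j | entry-⊙ r (Y ⊗ Y) i j
              | entry-⊖ B E i j | ℤP.pos-+ 1 (suc m)
        = normalise (entry E i j) (entry B i j) (entry (Y ⊗ Y) i j) (entry W i j) (entry (W ⊗ Y) i j) r
        where
        normalise : ∀ e b y² w v r → b + r * ((b - e) + y²) + (w + v) ≡ e + (1ℤ + r) * (b - e) + (r * y² + w + v)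
        normalise = solve-∀

    pow≡E⇒[1+m]Y≡-ZY² : ∀ m → pow B (suc m) ≡ E → ∀ i j → (+ suc m) * entry Y i j ≡ - entry (Z m ⊗ (Y ⊗ Y)) i j
    pow≡E⇒[1+m]Y≡-ZY² m Bᵐ⁺¹≡E i j = isolate (entry E i j) _ _ (begin
      entry E i j                                                   ≡⟨ cong (λ M → entry M i j) (trans (sym Bᵐ⁺¹≡E) (pow-expansion m)) ⟩
      entry (E ⊕ (+ suc m) ⊙ Y ⊕ Z m ⊗ (Y ⊗ Y)) i j                 ≡⟨ entry-⊕-⊙-⊕ E (+ suc m) Y (Z m ⊗ (Y ⊗ Y)) i j ⟩
      entry E i j + (+ suc m) * entry Y i j + entry (Z m ⊗ (Y ⊗ Y)) i j ∎)
      where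
      isolate : ∀ e a w → e ≡ e + a + w → a ≡ - w
      isolate e a w e≡e+a+w = begin
        a                   ≡⟨ expand e a w ⟩
        (e + a + w) - e - w ≡⟨ cong (λ x → x - e - w) e≡e+a+w ⟨
        e - e - w           ≡⟨ contract e w ⟩
        - w                 ∎
        where
        expand : ∀ e a w → a ≡ (e + a + w) - e - w
        expand = solve-∀
        contract : ∀ e w → e - e - w ≡ - w
        contract = solve-∀

    3∣ᴹZ₂ : + 3 ∣ᴹ Y → + 3 ∣ᴹ Z 2
    3∣ᴹZ₂ 3∣Y i j = subst (+ 3 ∣_) (sym (entry-⊕ ((+ 2) ⊙ identity n ⊕ Z 1) (Z 1 ⊗ Y) i j))
      (∣m∣n⇒∣m+n (divides (entry (identity n) i j) diagonal) (∣ᴹ-⊗ʳ (Z 1) {Y} 3∣Y i j))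
      where
      diagonal : entry ((+ 2) ⊙ identity n ⊕ Z 1) i j ≡ entry (identity n) i j * + 3
      diagonal
        rewrite entry-⊕ ((+ 2) ⊙ identity n) (Z 1) i j | entry-⊙ (+ 2) (identity n) i j
              | entry-⊕-⊙-⊕ (1ℤ ⊙ identity n) 0ℤ (identity n) ((0ℤ ⊙ identity n) ⊗ Y) i j
              | entry-⊙ 1ℤ (identity n) i j | ⊙-⊗ 0ℤ (identity n) Y | entry-⊙ 0ℤ (identity n ⊗ Y) i j
        = triple (entry (identity n) i j) (entry (identity n ⊗ Y) i j)
        where
        triple : ∀ δ z → + 2 * δ + (1ℤ * δ + 0ℤ * δ + 0ℤ * z) ≡ δ * + 3
        triple = solve-∀

    ladder-coprime : ∀ m k → pow B (suc m) ≡ E → ¬ 3 ℕ.∣ suc m → + (3 ^ suc k) ∣ᴹ Y → + (3 ^ suc (suc k)) ∣ᴹ Y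
    ladder-coprime m k Bᵐ⁺¹≡E 3∤m+1 t∣Y i j =
      subst (_∣ entry Y i j) (3*3^[1+k]≡3^[2+k] k) (∣-refine-coprime t {+ suc m} (3∣3^[1+k] k) (t∣Y i j) t²∣cY 3∤m+1)
      where
      t = + (3 ^ suc k)
      instance
        t≢0 : ℤ.NonZero t
        t≢0 = ℕP.m^n≢0 3 (suc k)
      t²∣cY : t * t ∣ (+ suc m) * entry Y i j
      t²∣cY = subst (t * t ∣_) (sym (pow≡E⇒[1+m]Y≡-ZY² m Bᵐ⁺¹≡E i j)) (∣m⇒∣-m (∣ᴹ-⊗ʳ (Z m) {Y ⊗ Y} (∣ᴹ-⊗ {M = Y} {Y} t∣Y t∣Y) i j))

    ladder-cube : ∀ k → pow B 3 ≡ E → + (3 ^ suc k) ∣ᴹ Y → + (3 ^ suc (suc k)) ∣ᴹ Y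
    ladder-cube k B³≡E t∣Y i j =
      subst (_∣ entry Y i j) (3*3^[1+k]≡3^[2+k] k) (∣-refine-cube (3∣3^[1+k] k) 3t²∣3Y)
      where
      3∣Y : + 3 ∣ᴹ Y
      3∣Y i j = ∣-trans (3∣3^[1+k] k) (t∣Y i j)
      3t²∣3Y : + 3 * (+ (3 ^ suc k) * + (3 ^ suc k)) ∣ + 3 * entry Y i j
      3t²∣3Y = subst (_ ∣_) (sym (pow≡E⇒[1+m]Y≡-ZY² 2 B³≡E i j)) (∣m⇒∣-m (∣ᴹ-⊗ {M = Z 2} {Y ⊗ Y} (3∣ᴹZ₂ 3∣Y) (∣ᴹ-⊗ {M = Y} {Y} t∣Y t∣Y) i j))

    cube-congruent : + 3 ∣ᴹ Y → + 3 ∣ᴹ pow B 3 ⊖ E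
    cube-congruent 3∣Y i j = subst (+ 3 ∣_) (sym entry≡) (∣m∣n⇒∣m+n (divides (entry Y i j) (ℤP.*-comm (+ 3) (entry Y i j))) (∣ᴹ-⊗ʳ (Z 2) {Y ⊗ Y} (∣ᴹ-⊗ʳ Y {Y} 3∣Y) i j))
      where
      W = Z 2 ⊗ (Y ⊗ Y)
      entry≡ : entry (pow B 3 ⊖ E) i j ≡ + 3 * entry Y i j + entry W i j
      entry≡ = begin
        entry (pow B 3 ⊖ E) i j                                   ≡⟨ entry-⊖ (pow B 3) E i j ⟩
        entry (pow B 3) i j - entry E i j                         ≡⟨ cong (λ M → entry M i j - entry E i j) (pow-expansion 2) ⟩
        entry (E ⊕ (+ 3) ⊙ Y ⊕ W) i j - entry E i j               ≡⟨ cong (_- entry E i j) (entry-⊕-⊙-⊕ E (+ 3) Y W i j) ⟩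
        entry E i j + + 3 * entry Y i j + entry W i j - entry E i j ≡⟨ drop (entry E i j) _ _ ⟩
        + 3 * entry Y i j + entry W i j                           ∎
        where
        drop : ∀ e a w → e + a + w - e ≡ a + w
        drop = solve-∀

    divisible-by-all-powers-of-3⇒B≡E : (∀ k → + (3 ^ suc k) ∣ᴹ Y) → B ≡ E
    divisible-by-all-powers-of-3⇒B≡E 3ᵏ∣Y = ⊖-≡0⇒≡ λ i j → divisible-by-all-powers-of-3⇒0 _ λ k → 3ᵏ∣Y k i j

  TrivialRoots : ℕ → Set
  TrivialRoots q = ∀ {B} → InCorner B → + 3 ∣ᴹ B ⊖ E → pow B (suc q) ≡ E → B ≡ E

  root-of-idempotent : ∀ q → TrivialRoots q
  root-of-idempotent = <-rec TrivialRoots root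
    where
    root : ∀ q → (∀ {s} → s < q → TrivialRoots s) → TrivialRoots q
    root q rec {B} corner 3∣B-E Bq⁺¹≡E with 3 ℕ.∣? suc q
    ... | no 3∤q+1 = divisible-by-all-powers-of-3⇒B≡E ladder
      where
      open Expansion corner
      ladder : ∀ k → + (3 ^ suc k) ∣ᴹ Y
      ladder zero    = 3∣B-E
      ladder (suc k) = ladder-coprime q k Bq⁺¹≡E 3∤q+1 (ladder k)
    -- When 3 ∣ q+1 the linear term (q+1) Y gains no factor 3, so first show B³ = E, a root of smaller
    -- order, and refine with B³ = E + 3 Y + Z 2 Y² instead, where 3 ∣ Z 2.
    ... | yes (ℕ.divides (suc s) q+1≡[s+1]*3) = divisible-by-all-powers-of-3⇒B≡E ladder
      where
      open Expansion corner
      q≡ : q ≡ suc (suc (s ℕ.* 3))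
      q≡ = ℕP.suc-injective q+1≡[s+1]*3
      B³≡E : pow B 3 ≡ E
      B³≡E = rec (subst (s <_) (sym q≡) (s≤s (ℕP.m≤n⇒m≤1+n (ℕP.m≤m*n s 3))))
               (pow-inCorner 2 corner) (cube-congruent 3∣B-E)
               (trans (sym (pow-* B 3 (suc s))) (trans (cong (pow B) (trans (ℕP.*-comm 3 (suc s)) (sym q+1≡[s+1]*3))) Bq⁺¹≡E))
      ladder : ∀ k → + (3 ^ suc k) ∣ᴹ Y
      ladder zero    = 3∣B-E
      ladder (suc k) = ladder-cube k B³≡E (ladder k)

-- Periodicity and counting

pow-period : ∀ {n} (A : Matrix n) {i P} → pow A (i ℕ.+ P) ≡ pow A i → ∀ {x} → i ≤ x → pow A (x ℕ.+ P) ≡ pow A x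
pow-period A {i} {P} Aⁱ⁺ᴾ≡Aⁱ {x} i≤x = begin
  pow A (x ℕ.+ P)             ≡⟨ cong (λ y → pow A (y ℕ.+ P)) x≡i+d ⟩
  pow A (i ℕ.+ d ℕ.+ P)       ≡⟨ cong (pow A) (swap i d P) ⟩
  pow A (i ℕ.+ P ℕ.+ d)       ≡⟨ pow-+ A (i ℕ.+ P) d ⟩
  pow A (i ℕ.+ P) ⊗ pow A d   ≡⟨ cong (_⊗ pow A d) Aⁱ⁺ᴾ≡Aⁱ ⟩
  pow A i ⊗ pow A d           ≡⟨ pow-+ A i d ⟨
  pow A (i ℕ.+ d)             ≡⟨ cong (pow A) x≡i+d ⟨
  pow A x                     ∎
  where
  d = x ℕ.∸ i
  x≡i+d : x ≡ i ℕ.+ d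
  x≡i+d = sym (ℕP.m+[n∸m]≡n i≤x)
  swap : ∀ i d P → i ℕ.+ d ℕ.+ P ≡ i ℕ.+ P ℕ.+ d
  swap = ℕ-Solver.solve-∀

pow-periodic : ∀ {n} (A : Matrix n) {i P} → pow A (i ℕ.+ P) ≡ pow A i → ∀ c {x} → i ≤ x → pow A (x ℕ.+ c ℕ.* P) ≡ pow A x
pow-periodic A         Aⁱ⁺ᴾ≡Aⁱ zero    {x} i≤x = cong (pow A) (ℕP.+-identityʳ x)
pow-periodic A {i} {P} Aⁱ⁺ᴾ≡Aⁱ (suc c) {x} i≤x = begin
  pow A (x ℕ.+ (P ℕ.+ c ℕ.* P))   ≡⟨ cong (pow A) (swap x P (c ℕ.* P)) ⟩
  pow A (x ℕ.+ c ℕ.* P ℕ.+ P)     ≡⟨ pow-period A Aⁱ⁺ᴾ≡Aⁱ (ℕP.≤-trans i≤x (ℕP.m≤m+n x (c ℕ.* P))) ⟩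
  pow A (x ℕ.+ c ℕ.* P)           ≡⟨ pow-periodic A Aⁱ⁺ᴾ≡Aⁱ c i≤x ⟩
  pow A x                         ∎
  where
  swap : ∀ x P y → x ℕ.+ (P ℕ.+ y) ≡ x ℕ.+ y ℕ.+ P
  swap = ℕ-Solver.solve-∀

-- E = A^(a P) is idempotent and B = A^(a P + m + 1) is a P-th root of E congruent to E, so B = E.
congruent-powers-equal : ∀ {n} (A : Matrix n) {i p} → pow A (i ℕ.+ suc p) ≡ pow A i → ∀ {a} m → i ≤ a →
  + 3 ∣ᴹ pow A (a ℕ.+ suc m) ⊖ pow A a → pow A (a ℕ.+ suc m) ≡ pow A a
congruent-powers-equal {n} A {i} {p} periodic {a} m i≤a 3∣ = begin
  pow A (a ℕ.+ suc m)                 ≡⟨ periodic-at (a ℕ.+ suc m) a (ℕP.≤-trans i≤a (ℕP.m≤m+n a (suc m))) ⟨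
  pow A (a ℕ.+ suc m ℕ.+ u)           ≡⟨ cong (pow A) (ℕP.+-assoc a (suc m) u) ⟩
  pow A (a ℕ.+ (suc m ℕ.+ u))         ≡⟨ cong (λ e → pow A (a ℕ.+ e)) (ℕP.+-comm (suc m) u) ⟩
  pow A (a ℕ.+ (u ℕ.+ suc m))         ≡⟨ pow-+ A a (u ℕ.+ suc m) ⟩
  pow A a ⊗ B                         ≡⟨ cong (pow A a ⊗_) B≡E ⟩
  pow A a ⊗ E                         ≡⟨ pow-+ A a u ⟨
  pow A (a ℕ.+ u)                     ≡⟨ periodic-at a a i≤a ⟩
  pow A a                             ∎
  where
  P = suc p
  u = a ℕ.* P
  i≤u : i ≤ u
  i≤u = ℕP.≤-trans i≤a (ℕP.m≤m*n a P)
  periodic-at : ∀ x c → i ≤ x → pow A (x ℕ.+ c ℕ.* P) ≡ pow A x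
  periodic-at x c = pow-periodic A periodic c
  E = pow A u
  B = pow A (u ℕ.+ suc m)
  open Minkowski {E = E} (trans (sym (pow-+ A u u)) (periodic-at u a i≤u))
  B∈corner : InCorner B
  B∈corner = trans (sym (pow-+ A (u ℕ.+ suc m) u)) B⁺ᵘ≡B
           , trans (sym (pow-+ A u (u ℕ.+ suc m))) (trans (cong (pow A) (ℕP.+-comm u (u ℕ.+ suc m))) B⁺ᵘ≡B)
    where
    B⁺ᵘ≡B : pow A (u ℕ.+ suc m ℕ.+ u) ≡ B
    B⁺ᵘ≡B = periodic-at (u ℕ.+ suc m) a (ℕP.≤-trans i≤u (ℕP.m≤m+n u (suc m)))
  u≡a+ap : u ≡ a ℕ.+ a ℕ.* p
  u≡a+ap = ℕP.*-suc a p
  B⊖E≡ : B ⊖ E ≡ (pow A (a ℕ.+ suc m) ⊖ pow A a) ⊗ pow A (a ℕ.* p)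
  B⊖E≡ = begin
    B ⊖ E   ≡⟨ cong₂ (λ x y → pow A x ⊖ pow A y) (cong (ℕ._+ suc m) u≡a+ap) u≡a+ap ⟩
    pow A (a ℕ.+ a ℕ.* p ℕ.+ suc m) ⊖ pow A (a ℕ.+ a ℕ.* p)
            ≡⟨ cong (_⊖ pow A (a ℕ.+ a ℕ.* p)) (cong (pow A) (swap a (a ℕ.* p) (suc m))) ⟩
    pow A (a ℕ.+ suc m ℕ.+ a ℕ.* p) ⊖ pow A (a ℕ.+ a ℕ.* p)
            ≡⟨ cong₂ _⊖_ (pow-+ A (a ℕ.+ suc m) (a ℕ.* p)) (pow-+ A a (a ℕ.* p)) ⟩
    pow A (a ℕ.+ suc m) ⊗ pow A (a ℕ.* p) ⊖ pow A a ⊗ pow A (a ℕ.* p)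
            ≡⟨ ⊖-distribʳ (pow A (a ℕ.+ suc m)) (pow A a) (pow A (a ℕ.* p)) ⟨
    (pow A (a ℕ.+ suc m) ⊖ pow A a) ⊗ pow A (a ℕ.* p) ∎
    where
    swap : ∀ a b c → a ℕ.+ b ℕ.+ c ≡ a ℕ.+ c ℕ.+ b
    swap = ℕ-Solver.solve-∀
  Bᴾ≡E : pow B P ≡ E
  Bᴾ≡E = begin
    pow B P                                   ≡⟨ pow-* A (u ℕ.+ suc m) P ⟨
    pow A ((u ℕ.+ suc m) ℕ.* P)               ≡⟨ cong (pow A) (expand a p m) ⟩
    pow A (u ℕ.+ (a ℕ.* p ℕ.+ suc m) ℕ.* P)   ≡⟨ periodic-at u (a ℕ.* p ℕ.+ suc m) i≤u ⟩
    E                                         ∎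
    where
    expand : ∀ a p m → (a ℕ.* suc p ℕ.+ suc m) ℕ.* suc p ≡ a ℕ.* suc p ℕ.+ (a ℕ.* p ℕ.+ suc m) ℕ.* suc p
    expand = ℕ-Solver.solve-∀
  B≡E : B ≡ E
  B≡E = root-of-idempotent p B∈corner (subst (+ 3 ∣ᴹ_) (sym B⊖E≡) (∣ᴹ-⊗ˡ {M = pow A (a ℕ.+ suc m) ⊖ pow A a} (pow A (a ℕ.* p)) 3∣)) Bᴾ≡E

residue : ℤ → Fin 3
residue x = fromℕ< (n%ℕd<d x 3)

residue-≡⇒3∣- : ∀ x y → residue x ≡ residue y → + 3 ∣ x - y
residue-≡⇒3∣- x y eq = divides (x /ℕ 3 - y /ℕ 3) (begin
  x - y                                                 ≡⟨ cong₂ _-_ (a≡a%ℕn+[a/ℕn]*n x 3) (a≡a%ℕn+[a/ℕn]*n y 3) ⟩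
  (+ (x %ℕ 3) + x /ℕ 3 * + 3) - (+ (y %ℕ 3) + y /ℕ 3 * + 3) ≡⟨ cong (λ r → (+ (x %ℕ 3) + x /ℕ 3 * + 3) - (+ r + y /ℕ 3 * + 3)) x%3≡y%3 ⟨
  (+ (x %ℕ 3) + x /ℕ 3 * + 3) - (+ (x %ℕ 3) + y /ℕ 3 * + 3) ≡⟨ cancel (+ (x %ℕ 3)) (x /ℕ 3) (y /ℕ 3) ⟩
  (x /ℕ 3 - y /ℕ 3) * + 3                               ∎)
  where
  x%3≡y%3 : x %ℕ 3 ≡ y %ℕ 3
  x%3≡y%3 = trans (sym (FinP.toℕ-fromℕ< _)) (trans (cong toℕ eq) (FinP.toℕ-fromℕ< _))
  cancel : ∀ r a b → (r + a * + 3) - (r + b * + 3) ≡ (a - b) * + 3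
  cancel = solve-∀

residues : ∀ {n} → Matrix n → Fin (3 ^ (n ℕ.* n))
residues {n} M = funToFin λ t → let i , j = remQuot n t in residue (entry M i j)

residues-≡⇒3∣ᴹ : ∀ {n} (M N : Matrix n) → residues M ≡ residues N → + 3 ∣ᴹ M ⊖ N
residues-≡⇒3∣ᴹ {n} M N eq i j =
  subst (+ 3 ∣_) (sym (entry-⊖ M N i j)) (residue-≡⇒3∣- (entry M i j) (entry N i j) same-residue)
  where
  same-residue : residue (entry M i j) ≡ residue (entry N i j)
  same-residue = subst (λ (k , l) → residue (entry M k l) ≡ residue (entry N k l)) (FinP.remQuot-combine i j)
    (trans (sym (FinP.finToFun-funToFin _ (combine i j)))
      (trans (cong (λ r → finToFun r (combine i j)) eq) (FinP.finToFun-funToFin _ (combine i j))))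

m<n⇒m+[1+[n∸1+m]]≡n : ∀ {m n} → m < n → m ℕ.+ suc (n ℕ.∸ suc m) ≡ n
m<n⇒m+[1+[n∸1+m]]≡n {m} m<n = trans (ℕP.+-suc m _) (ℕP.m+[n∸m]≡n m<n)

congruent-powers : ∀ {n} (A : Matrix n) s →
  ∃₂ λ a m → a ℕ.+ suc m ≤ 3 ^ (n ℕ.* n) × + 3 ∣ᴹ pow A (s ℕ.+ a ℕ.+ suc m) ⊖ pow A (s ℕ.+ a)
congruent-powers {n} A s with FinP.pigeonhole (ℕP.n<1+n _) (λ t → residues (pow A (s ℕ.+ toℕ t)))
... | x , y , x<y , same-residues =
  toℕ x , toℕ y ℕ.∸ suc (toℕ x) ,
  subst (_≤ 3 ^ (n ℕ.* n)) (sym (m<n⇒m+[1+[n∸1+m]]≡n x<y)) (FinP.toℕ≤pred[n] y) ,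
  subst (λ e → + 3 ∣ᴹ pow A e ⊖ pow A (s ℕ.+ toℕ x))
        (trans (cong (s ℕ.+_) (sym (m<n⇒m+[1+[n∸1+m]]≡n x<y))) (sym (ℕP.+-assoc s (toℕ x) _)))
        (residues-≡⇒3∣ᴹ (pow A (s ℕ.+ toℕ y)) (pow A (s ℕ.+ toℕ x)) (sym same-residues))

bounded-repeat : ∀ {n} (A : Matrix n) {i p} → pow A (i ℕ.+ suc p) ≡ pow A i →
  ∃₂ λ a m → a ℕ.+ suc m ≤ i ℕ.+ 3 ^ (n ℕ.* n) × pow A (a ℕ.+ suc m) ≡ pow A a
bounded-repeat {n} A {i} periodic =
  let a , m , a+m+1≤ , 3∣ = congruent-powers A i
  in i ℕ.+ a , m ,
     subst (_≤ i ℕ.+ 3 ^ (n ℕ.* n)) (sym (ℕP.+-assoc i a (suc m))) (ℕP.+-monoʳ-≤ i a+m+1≤) ,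
     congruent-powers-equal A periodic m (ℕP.m≤m+n i a) 3∣

finite⇒repeat : ∀ {n} (A : Matrix n) → PowersFinite A → ∃₂ λ i p → pow A (i ℕ.+ suc p) ≡ pow A i
finite⇒repeat A (L , all∈L) with FinP.pigeonhole (ℕP.n<1+n (length L)) (λ t → Any.index (all∈L (toℕ t)))
... | x , y , x<y , same-index = toℕ x , toℕ y ℕ.∸ suc (toℕ x) , (begin
  pow A (toℕ x ℕ.+ suc (toℕ y ℕ.∸ suc (toℕ x)))   ≡⟨ cong (pow A) (m<n⇒m+[1+[n∸1+m]]≡n x<y) ⟩
  pow A (toℕ y)                                   ≡⟨ AnyP.lookup-index (all∈L (toℕ y)) ⟩
  List.lookup L (Any.index (all∈L (toℕ y)))        ≡⟨ cong (List.lookup L) same-index ⟨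
  List.lookup L (Any.index (all∈L (toℕ x)))        ≡⟨ AnyP.lookup-index (all∈L (toℕ x)) ⟨
  pow A (toℕ x)                                   ∎)

preperiod≤dim : ∀ {n} (A : Matrix n) {i P} → pow A (i ℕ.+ P) ≡ pow A i → pow A (n ℕ.+ P) ≡ pow A n
preperiod≤dim {n} A {i} {P} periodic =
  trans (pow-+ A n P) (pow-absorbs⇒pow-dim-absorbs A i (pow A P) (trans (sym (pow-+ A i P)) periodic))

repeat⇒PowersCardLe : ∀ {n} (A : Matrix n) {a m} → pow A (a ℕ.+ suc m) ≡ pow A a → PowersCardLe A (a ℕ.+ suc m)
repeat⇒PowersCardLe A {a} {m} cycle =
  applyUpTo (pow A) N , ℕP.≤-reflexive (ListP.length-applyUpTo (pow A) N) ,
  λ k → let k′ , k′<N , Aᵏ≡Aᵏ′ = reduce k in subst (_∈ applyUpTo (pow A) N) (sym Aᵏ≡Aᵏ′) (∈-applyUpTo⁺ (pow A) k′<N)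
  where
  N = a ℕ.+ suc m
  reduce : ∀ k → ∃ λ k′ → k′ < N × pow A k ≡ pow A k′
  reduce k with a ℕ.≤? k
  ... | no  a≰k = k , ℕP.<-≤-trans (ℕP.≰⇒> a≰k) (ℕP.m≤m+n a (suc m)) , refl
  ... | yes a≤k = a ℕ.+ r , ℕP.+-monoʳ-< a (ℕDM.m%n<n d (suc m)) , (begin
    pow A k                             ≡⟨ cong (pow A) k≡ ⟩
    pow A (a ℕ.+ r ℕ.+ q ℕ.* suc m)     ≡⟨ pow-periodic A cycle q (ℕP.m≤m+n a r) ⟩
    pow A (a ℕ.+ r)                     ∎)
    where
    d = k ℕ.∸ a
    r = d ℕ.% suc m
    q = d ℕ./ suc m
    k≡ : k ≡ a ℕ.+ r ℕ.+ q ℕ.* suc m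
    k≡ = trans (sym (ℕP.m+[n∸m]≡n a≤k))
           (trans (cong (a ℕ.+_) (ℕDM.m≡m%n+[m/n]*n d (suc m))) (sym (ℕP.+-assoc a r _)))

PowersCardLe-mono : ∀ {n} {A : Matrix n} {N M} → N ≤ M → PowersCardLe A N → PowersCardLe A M
PowersCardLe-mono N≤M (L , length≤N , all∈L) = L , ℕP.≤-trans length≤N N≤M , all∈L

x+3^x≤4^x : ∀ x → x ℕ.+ 3 ^ x ≤ 4 ^ x
x+3^x≤4^x zero    = ℕP.≤-refl
x+3^x≤4^x (suc x) = step x (3 ^ x) (4 ^ x) (ℕP.m^n>0 3 x) (x+3^x≤4^x x)
  where
  step : ∀ x a b → 1 ≤ a → x ℕ.+ a ≤ b → suc x ℕ.+ 3 ℕ.* a ≤ 4 ℕ.* b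
  step x (suc a) b _ x+a≤b =
    ℕP.≤-trans (subst (suc x ℕ.+ 3 ℕ.* suc a ≤_) (sym (split x a)) (ℕP.m≤m+n _ _)) (ℕP.*-monoʳ-≤ 4 x+a≤b)
    where
    split : ∀ x a → 4 ℕ.* (x ℕ.+ suc a) ≡ (suc x ℕ.+ 3 ℕ.* suc a) ℕ.+ (3 ℕ.* x ℕ.+ a)
    split = ℕ-Solver.solve-∀

n+3^n²≤2^n³ : ∀ n → 2 ≤ n → n ℕ.+ 3 ^ (n ℕ.* n) ≤ 2 ^ (n ^ 3)
n+3^n²≤2^n³ n@(suc _) 2≤n =
  ℕP.≤-trans (ℕP.+-monoˡ-≤ (3 ^ (n ℕ.* n)) (ℕP.m≤m*n n n))
    (ℕP.≤-trans (x+3^x≤4^x (n ℕ.* n))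
      (subst (_≤ 2 ^ (n ^ 3)) (sym (ℕP.^-*-assoc 2 2 (n ℕ.* n))) (ℕP.^-monoʳ-≤ 2 2n²≤n³)))
  where
  2n²≤n³ : 2 ℕ.* (n ℕ.* n) ≤ n ^ 3
  2n²≤n³ = subst (2 ℕ.* (n ℕ.* n) ≤_) (cong (λ z → n ℕ.* (n ℕ.* z)) (sym (ℕP.*-identityʳ n))) (ℕP.*-monoˡ-≤ (n ℕ.* n) 2≤n)

finite⇒PowersCardLe : ∀ n → 2 ≤ n → (A : Matrix n) → PowersFinite A → PowersCardLe A (2 ^ (n ^ 3))
finite⇒PowersCardLe n 2≤n A finite =
  let i , p , periodic = finite⇒repeat A finite
      a , m , a+m+1≤ , cycle = bounded-repeat A (preperiod≤dim A {i} {suc p} periodic)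
  in PowersCardLe-mono (ℕP.≤-trans a+m+1≤ (n+3^n²≤2^n³ n 2≤n)) (repeat⇒PowersCardLe A cycle)

lemma13 : (n : ℕ) → 2 ≤ n → (A : Matrix n) →
    PowersFinite A ⇔ PowersCardLe A (2 ^ (n ^ 3))
lemma13 n 2≤n A = mk⇔ (finite⇒PowersCardLe n 2≤n A) λ (L , _ , all∈L) → L , all∈L
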